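{- Let $G$ be a finite simple graph with $n$ vertices. Then for every natural number $s\geq3$, $$\varphi^{(s)}(G)\geq\frac{n}{n-D_3(G)}.$$
   Context: Let $d(v)$ denote the degree of $v$. For nonempty $W\subseteq V(G)$ and natural $k$, $D_k(W)=\left(\frac{1}{|W|}\sum_{v\in W}d^k(v)\right)^{1/k}$ and $D_k(G)=D_k(V(G))$. $W$ is a $\delta_k$-small set if $D_k(W)\leq n-|W|$. $\varphi^{(s)}(G)$ is the smallest natural number $r$ such that $V(G)$ is a disjoint union of $r$ $\delta_s$-small sets. -}

module Defs where

open import Data.Nat using (ℕ; zero; suc; _+_; _*_; _∸_; _^_; _≤_)
open import Data.Bool using (Bool; true; false; if_then_else_)
open import Data.Fin using (Fin; _≟_)
import Data.Fin as F
open import Data.Product using (Σ; _×_)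
open import Relation.Nullary.Decidable using (⌊_⌋)
open import Relation.Binary.PropositionalEquality using (_≡_)

record SimpleGraph (n : ℕ) : Set where
  field
    adj    : Fin n → Fin n → Bool
    sym    : ∀ u v → adj u v ≡ adj v u
    irrefl : ∀ v → adj v v ≡ false
open SimpleGraph public

sumFin : ∀ {n} → (Fin n → ℕ) → ℕ
sumFin {zero}  f = 0
sumFin {suc n} f = f F.zero + sumFin (λ v → f (F.suc v))

𝟙 : Bool → ℕ
𝟙 true  = 1
𝟙 false = 0

deg : ∀ {n} → SimpleGraph n → Fin n → ℕ
deg G v = sumFin (λ w → 𝟙 (adj G v w))

Subset : ℕ → Set
Subset n = Fin n → Bool

card : ∀ {n} → Subset n → ℕ
card W = sumFin (λ v → 𝟙 (W v))

-- Σ_{v ∈ W} d(v)^k   (so that D_k(W)^k = powSum k W / |W|)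
powSum : ∀ {n} → SimpleGraph n → ℕ → Subset n → ℕ
powSum G k W = sumFin (λ v → 𝟙 (W v) * deg G v ^ k)

-- W is δ_k-small:  W nonempty and D_k(W) ≤ n - |W|.
-- Since both sides are ≥ 0 (|W| ≤ n), D_k(W) ≤ n - |W| is equivalent to
-- D_k(W)^k ≤ (n - |W|)^k, i.e.  Σ_{v∈W} d(v)^k ≤ |W| · (n - |W|)^k.
IsSmall : ∀ {n} → SimpleGraph n → ℕ → Subset n → Set
IsSmall {n} G k W = (1 ≤ card W) × (powSum G k W ≤ card W * (n ∸ card W) ^ k)

class : ∀ {n r} → (Fin n → Fin r) → Fin r → Subset n
class f i v = ⌊ f v ≟ i ⌋

-- V(G) is a disjoint union of r δ_k-small sets: a map f : V → Fin r
-- whose r classes (the parts) are each δ_k-small (in particular nonempty).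
SmallPartition : ∀ {n} → SimpleGraph n → ℕ → ℕ → Set
SmallPartition {n} G k r =
  Σ (Fin n → Fin r) (λ f → ∀ i → IsSmall G k (class f i))

allV : ∀ {n} → Subset n
allV v = true

{-# OPTIONS --safe #-}
-- Power means increase with the order (weighted AM-GM lowers the exponent one step at a time),
-- so every part W of a δ_s-small partition with s ≥ 3 is δ_3-small.  Summing over the r parts,
-- Σ d³ ≤ Σᵢ wᵢ (n − wᵢ)³ where the part sizes wᵢ add up to n.  For r ≥ 3 each term is below the
-- tangent of x ↦ x (n − x)³ at x = n / r, and summing the tangents gives n⁴ (r − 1)³ / r³;
-- for r = 2 the bound is 8 a b (a² + b²) ≤ (a + b)⁴.
module Submission where

open import Defs
open import Data.Nat using (ℕ; _*_; _∸_; _^_; _≤_)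
open import Data.Nat using (zero; suc; _+_; z≤n; s≤s; _≤′_; ≤′-refl; ≤′-step)
open import Data.Nat.Properties hiding (_≟_)
open import Data.Nat.Tactic.RingSolver using (solve-∀)
open import Data.Fin using (Fin; _≟_)
import Data.Fin as F
open import Data.Fin.Patterns using (0F; 1F)
open import Data.Product using (_,_; proj₂)
open import Data.Sum using (inj₁; inj₂)
open import Function using (_∘_)
open import Relation.Nullary.Decidable using (⌊_⌋; ⌊⌋-map′)
open import Relation.Binary.PropositionalEquality renaming (sym to ≡-sym)
open import Algebra.Properties.Semiring.Sum +-*-semiring
  using (sum; sum-cong-≗; ∑-distrib-+; ∑-comm; *-distribˡ-sum)

sumFin≡sum : ∀ {n} (f : Fin n → ℕ) → sumFin f ≡ sum f
sumFin≡sum {zero}  f = refl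
sumFin≡sum {suc n} f = cong (f 0F +_) (sumFin≡sum (f ∘ F.suc))

sumFin-cong : ∀ {n} {f g : Fin n → ℕ} → (∀ v → f v ≡ g v) → sumFin f ≡ sumFin g
sumFin-cong {f = f} {g} f≗g =
  trans (sumFin≡sum f) (trans (sum-cong-≗ f≗g) (≡-sym (sumFin≡sum g)))

sumFin-distrib-+ : ∀ {n} (f g : Fin n → ℕ) →
  sumFin (λ v → f v + g v) ≡ sumFin f + sumFin g
sumFin-distrib-+ f g =
  trans (sumFin≡sum (λ v → f v + g v))
    (trans (∑-distrib-+ f g) (≡-sym (cong₂ _+_ (sumFin≡sum f) (sumFin≡sum g))))

*-distribˡ-sumFin : ∀ {n} c (f : Fin n → ℕ) → c * sumFin f ≡ sumFin (λ v → c * f v)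
*-distribˡ-sumFin c f =
  trans (cong (c *_) (sumFin≡sum f)) (trans (*-distribˡ-sum c f) (≡-sym (sumFin≡sum (λ v → c * f v))))

sumFin-comm : ∀ {m n} (h : Fin m → Fin n → ℕ) →
  sumFin (λ i → sumFin (h i)) ≡ sumFin (λ j → sumFin (λ i → h i j))
sumFin-comm h = trans (sumFin²≡sum² h) (trans (∑-comm h) (≡-sym (sumFin²≡sum² (λ j i → h i j))))
  where
  sumFin²≡sum² : ∀ {m n} (h : Fin m → Fin n → ℕ) →
    sumFin (λ i → sumFin (h i)) ≡ sum (λ i → sum (h i))
  sumFin²≡sum² h = trans (sumFin≡sum (sumFin ∘ h)) (sum-cong-≗ (sumFin≡sum ∘ h))

sumFin-linear : ∀ {n} a b (f g : Fin n → ℕ) →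
  sumFin (λ v → a * f v + b * g v) ≡ a * sumFin f + b * sumFin g
sumFin-linear a b f g =
  trans (sumFin-distrib-+ (λ v → a * f v) (λ v → b * g v))
    (≡-sym (cong₂ _+_ (*-distribˡ-sumFin a f) (*-distribˡ-sumFin b g)))

sumFin-const : ∀ {n} c → sumFin {n} (λ _ → c) ≡ n * c
sumFin-const {zero}  c = refl
sumFin-const {suc n} c = cong (c +_) (sumFin-const {n} c)

sumFin-mono-≤ : ∀ {n} {f g : Fin n → ℕ} → (∀ v → f v ≤ g v) → sumFin f ≤ sumFin g
sumFin-mono-≤ {zero}  f≤g = z≤n
sumFin-mono-≤ {suc n} f≤g = +-mono-≤ (f≤g 0F) (sumFin-mono-≤ (f≤g ∘ F.suc))

term≤sumFin : ∀ {n} (f : Fin n → ℕ) i → f i ≤ sumFin f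
term≤sumFin f 0F        = m≤m+n (f 0F) _
term≤sumFin f (F.suc i) = ≤-trans (term≤sumFin (f ∘ F.suc) i) (m≤n+m _ (f 0F))

sumFin-select : ∀ {r} (j : Fin r) c → sumFin (λ i → 𝟙 ⌊ j ≟ i ⌋ * c) ≡ c
sumFin-select {suc r} 0F c =
  trans (cong₂ _+_ (+-identityʳ c) (trans (sumFin-const {r} 0) (*-zeroʳ r))) (+-identityʳ c)
sumFin-select (F.suc j) c =
  trans (sumFin-cong (λ i → cong (λ b → 𝟙 b * c) (⌊⌋-map′ _ _ (j ≟ i)))) (sumFin-select j c)

sumFin-partition : ∀ {n r} (f : Fin n → Fin r) (g : Fin n → ℕ) →
  sumFin (λ i → sumFin (λ v → 𝟙 (class f i v) * g v)) ≡ sumFin g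
sumFin-partition {n} f g =
  trans (sumFin-comm (λ i v → 𝟙 (class f i v) * g v)) (sumFin-cong {n} (λ v → sumFin-select (f v) (g v)))

powSum-partition : ∀ {n r} (G : SimpleGraph n) k (f : Fin n → Fin r) →
  sumFin (λ i → powSum G k (class f i)) ≡ powSum G k allV
powSum-partition {n} G k f =
  trans (sumFin-partition f (λ v → deg G v ^ k)) (sumFin-cong {n} (λ v → ≡-sym (*-identityˡ _)))

card-partition : ∀ {n r} (f : Fin n → Fin r) → sumFin (λ i → card (class f i)) ≡ n
card-partition {n} {r} f = begin
  sumFin (λ i → card (class f i))                     ≡⟨ sumFin-cong {r} (λ i → sumFin-cong {n} (λ v → ≡-sym (*-identityʳ _))) ⟩
  sumFin (λ i → sumFin (λ v → 𝟙 (class f i v) * 1))  ≡⟨ sumFin-partition f (λ _ → 1) ⟩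
  sumFin {n} (λ _ → 1)                                ≡⟨ sumFin-const {n} 1 ⟩
  n * 1                                               ≡⟨ *-identityʳ n ⟩
  n                                                   ∎
  where open ≡-Reasoning

rearrangement : ∀ {a b x y} → a ≤ b → x ≤ y → a * y + b * x ≤ a * x + b * y
rearrangement {a} {x = x} a≤b x≤y with m≤n⇒∃[o]m+o≡n a≤b | m≤n⇒∃[o]m+o≡n x≤y
... | e , refl | f , refl = ≤-trans (m≤m+n _ (e * f)) (≤-reflexive (expand a e x f))
  where
  expand : ∀ a e x f → a * (x + f) + (a + e) * x + e * f ≡ a * x + (a + e) * (x + f)
  expand = solve-∀

similarly-ordered : ∀ (φ : ℕ → ℕ) → (∀ {a b} → a ≤ b → φ a ≤ φ b) →
  ∀ a b → a * φ b + b * φ a ≤ a * φ a + b * φ b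
similarly-ordered φ mono a b with ≤-total a b
... | inj₁ a≤b = rearrangement a≤b (mono a≤b)
... | inj₂ b≤a = subst₂ _≤_ (+-comm (b * φ a) (a * φ b)) (+-comm (b * φ b) (a * φ a))
                   (rearrangement b≤a (mono b≤a))

m*n+n*m≤m*m+n*n : ∀ m n → m * n + n * m ≤ m * m + n * n
m*n+n*m≤m*m+n*n = similarly-ordered (λ x → x) (λ x≤y → x≤y)

weighted-am-gm : ∀ k m d → suc k * m * d ^ k ≤ k * d ^ suc k + m ^ suc k
weighted-am-gm zero m d =
  ≤-reflexive (trans (*-identityʳ _) (trans (+-identityʳ m) (≡-sym (*-identityʳ m))))
weighted-am-gm (suc k) m d = begin
  (2 + k) * m * (d * X)                      ≡⟨ split k m d X ⟩
  d * (suc k * m * X) + m * (d * X)          ≤⟨ +-monoˡ-≤ _ (*-monoʳ-≤ d (weighted-am-gm k m d)) ⟩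
  d * (k * (d * X) + Y) + m * (d * X)        ≡⟨ regroup k m d X Y ⟩
  k * (d * (d * X)) + (d * Y + m * (d * X))  ≤⟨ +-monoʳ-≤ (k * (d * (d * X))) (similarly-ordered (_^ suc k) (^-monoˡ-≤ (suc k)) d m) ⟩
  k * (d * (d * X)) + (d * (d * X) + m * Y)  ≡⟨ merge k m d X Y ⟩
  suc k * (d * (d * X)) + m * Y              ∎
  where
  open ≤-Reasoning
  X = d ^ k
  Y = m ^ suc k
  split : ∀ k m d X → (2 + k) * m * (d * X) ≡ d * ((1 + k) * m * X) + m * (d * X)
  split = solve-∀
  regroup : ∀ k m d X Y → d * (k * (d * X) + Y) + m * (d * X) ≡ k * (d * (d * X)) + (d * Y + m * (d * X))
  regroup = solve-∀
  merge : ∀ k m d X Y → k * (d * (d * X)) + (d * (d * X) + m * Y) ≡ (1 + k) * (d * (d * X)) + m * Y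
  merge = solve-∀

-- With c = 𝟙 ∘ W and d = deg G this says D_k(W) ≤ m; the second component of
-- IsSmall G k W is literally PowerMeanBound (𝟙 ∘ W) (deg G) (n ∸ card W) k.
PowerMeanBound : ∀ {n} → (c d : Fin n → ℕ) → ℕ → ℕ → Set
PowerMeanBound c d m k = sumFin (λ v → c v * d v ^ k) ≤ sumFin c * m ^ k

d^[1+k]≤d^[2+k] : ∀ k d → d ^ suc k ≤ d ^ suc (suc k)
d^[1+k]≤d^[2+k] k zero       = z≤n
d^[1+k]≤d^[2+k] k d@(suc _) = ^-monoʳ-≤ d (n≤1+n (suc k))

powerMeanBound-pred : ∀ {n} (c d : Fin n → ℕ) m k →
  PowerMeanBound c d m (suc (suc k)) → PowerMeanBound c d m (suc k)
powerMeanBound-pred c d zero k bound = begin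
  sumFin (λ v → c v * d v ^ suc k)        ≤⟨ sumFin-mono-≤ (λ v → *-monoʳ-≤ (c v) (d^[1+k]≤d^[2+k] k (d v))) ⟩
  sumFin (λ v → c v * d v ^ suc (suc k))  ≤⟨ bound ⟩
  sumFin c * 0                            ≡⟨ *-zeroʳ (sumFin c) ⟩
  0                                       ≤⟨ z≤n ⟩
  sumFin c * 0 ^ suc k                    ∎
  where open ≤-Reasoning
powerMeanBound-pred c d m@(suc _) k bound = *-cancelˡ-≤ ((2 + k) * m) (begin
  (2 + k) * m * sumFin (λ v → c v * d v ^ suc k)
    ≡⟨ *-distribˡ-sumFin ((2 + k) * m) (λ v → c v * d v ^ suc k) ⟩
  sumFin (λ v → (2 + k) * m * (c v * d v ^ suc k))
    ≤⟨ sumFin-mono-≤ (λ v → weighted-am-gm-scaled (c v) (d v)) ⟩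
  sumFin (λ v → suc k * (c v * d v ^ suc (suc k)) + M * c v)
    ≡⟨ sumFin-linear (suc k) M (λ v → c v * d v ^ suc (suc k)) c ⟩
  suc k * sumFin (λ v → c v * d v ^ suc (suc k)) + M * sumFin c
    ≤⟨ +-monoˡ-≤ (M * sumFin c) (*-monoʳ-≤ (suc k) bound) ⟩
  suc k * (sumFin c * M) + M * sumFin c
    ≡⟨ collect k m (sumFin c) (m ^ suc k) ⟩
  (2 + k) * m * (sumFin c * m ^ suc k) ∎)
  where
  open ≤-Reasoning
  M = m ^ suc (suc k)
  weighted-am-gm-scaled : ∀ a x →
    (2 + k) * m * (a * x ^ suc k) ≤ suc k * (a * x ^ suc (suc k)) + M * a
  weighted-am-gm-scaled a x =
    subst₂ _≤_ (scale k m a (x ^ suc k)) (distribute k a (x ^ suc (suc k)) M)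
      (*-monoʳ-≤ a (weighted-am-gm (suc k) m x))
    where
    scale : ∀ k m a X → a * ((2 + k) * m * X) ≡ (2 + k) * m * (a * X)
    scale = solve-∀
    distribute : ∀ k a X M → a * (suc k * X + M) ≡ suc k * (a * X) + M * a
    distribute = solve-∀
  collect : ∀ k m S P → suc k * (S * (m * P)) + m * P * S ≡ (2 + k) * m * (S * P)
  collect = solve-∀

powerMeanBound-antitone : ∀ {n} (c d : Fin n → ℕ) m {j k} → j ≤ k →
  PowerMeanBound c d m (suc k) → PowerMeanBound c d m (suc j)
powerMeanBound-antitone c d m j≤k = go (≤⇒≤′ j≤k)
  where
  go : ∀ {j k} → j ≤′ k → PowerMeanBound c d m (suc k) → PowerMeanBound c d m (suc j)
  go ≤′-refl          bound = bound
  go (≤′-step {k} j≤k) bound = go j≤k (powerMeanBound-pred c d m k bound)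

-- The ring solver does not handle _^_, so its identities spell powers out: x ^ 3 = x * (x * (x * 1)).
two-part-bound : ∀ a b → 8 * (a * b ^ 3 + b * a ^ 3) ≤ (a + b) ^ 4
two-part-bound a b = begin
  8 * (a * b ^ 3 + b * a ^ 3)          ≡⟨ as-products a b ⟩
  P * M + M * P + (P * M + M * P)      ≤⟨ +-monoʳ-≤ (P * M + M * P) (m*n+n*m≤m*m+n*n P M) ⟩
  P * M + M * P + (P * P + M * M)      ≡⟨ as-square a b ⟩
  (a + b) ^ 4                          ∎
  where
  open ≤-Reasoning
  P = a * a + b * b
  M = a * b + b * a
  as-products : ∀ a b → 8 * (a * (b * (b * (b * 1))) + b * (a * (a * (a * 1))))
    ≡ (a * a + b * b) * (a * b + b * a) + (a * b + b * a) * (a * a + b * b)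
      + ((a * a + b * b) * (a * b + b * a) + (a * b + b * a) * (a * a + b * b))
  as-products = solve-∀
  as-square : ∀ a b →
    (a * a + b * b) * (a * b + b * a) + (a * b + b * a) * (a * a + b * b)
      + ((a * a + b * b) * (a * a + b * b) + (a * b + b * a) * (a * b + b * a))
    ≡ (a + b) * ((a + b) * ((a + b) * ((a + b) * 1)))
  as-square = solve-∀

-- For fixed n the right-hand side is affine in w: it is the tangent of the left-hand side at
-- w = n / (3 + k), and the difference of the two sides is ((2 + k) w − m)² Q with m = n − w.
tangent-bound : ∀ k {w n} → w ≤ n →
  (3 + k) ^ 4 * (w * (n ∸ w) ^ 3) ≤ k * (2 + k) ^ 3 * n ^ 3 * w + 3 * (2 + k) ^ 2 * n ^ 3 * (n ∸ w)
tangent-bound k {w} w≤n with m≤n⇒∃[o]m+o≡n w≤n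
... | m , refl rewrite m+n∸m≡n w m =
  +-cancelʳ-≤ ((a * a + m * m) * Q) _ _
    (≤-trans (≤-reflexive (tangent-identity k w m))
             (+-monoʳ-≤ _ (*-monoˡ-≤ Q (m*n+n*m≤m*m+n*n a m))))
  where
  a = (2 + k) * w
  Q = k * (2 + k) * (w * w) + (3 * k * k + 8 * k + 3) * w * m + 3 * (2 + k) ^ 2 * (m * m)
  tangent-identity : ∀ k w m →
    let q = 2 + k
        n = w + m
        a = q * w
        Q = k * q * (w * w) + (3 * k * k + 8 * k + 3) * w * m + 3 * (q * (q * 1)) * (m * m)
    in  (3 + k) * ((3 + k) * ((3 + k) * ((3 + k) * 1))) * (w * (m * (m * (m * 1))))
          + (a * a + m * m) * Q
        ≡ k * (q * (q * (q * 1))) * (n * (n * (n * 1))) * w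
          + 3 * (q * (q * 1)) * (n * (n * (n * 1))) * m + (a * m + m * a) * Q
  tangent-identity = solve-∀

sumFin-complement : ∀ {r} n (w : Fin (suc r) → ℕ) → sumFin w ≡ n →
  sumFin (λ i → n ∸ w i) ≡ r * n
sumFin-complement {r} n w Σw≡n = +-cancelˡ-≡ n _ _ (begin
  n + sumFin (λ i → n ∸ w i)           ≡⟨ cong (_+ sumFin (λ i → n ∸ w i)) (≡-sym Σw≡n) ⟩
  sumFin w + sumFin (λ i → n ∸ w i)    ≡⟨ ≡-sym (sumFin-distrib-+ w (λ i → n ∸ w i)) ⟩
  sumFin (λ i → w i + (n ∸ w i))       ≡⟨ sumFin-cong {suc r} (λ i → m+[n∸m]≡n (w≤n i)) ⟩
  sumFin {suc r} (λ _ → n)             ≡⟨ sumFin-const {suc r} n ⟩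
  suc r * n                            ∎)
  where
  open ≡-Reasoning
  w≤n : ∀ i → w i ≤ n
  w≤n i = subst (w i ≤_) Σw≡n (term≤sumFin w i)

cubic-partition-bound : ∀ {r} n (w : Fin r → ℕ) → sumFin w ≡ n →
  r ^ 3 * sumFin (λ i → w i * (n ∸ w i) ^ 3) ≤ n ^ 4 * (r ∸ 1) ^ 3
cubic-partition-bound {0} n w Σw≡n = z≤n
cubic-partition-bound {1} n w Σw≡n with trans (≡-sym (+-identityʳ (w 0F))) Σw≡n
... | refl rewrite n∸n≡0 (w 0F) | *-zeroʳ (w 0F) = z≤n
cubic-partition-bound {2} n w Σw≡n with trans (cong (w 0F +_) (≡-sym (+-identityʳ (w 1F)))) Σw≡n
... | refl rewrite m+n∸m≡n (w 0F) (w 1F) | m+n∸n≡m (w 0F) (w 1F) =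
  subst₂ _≤_ (cong (λ x → 8 * (w 0F * w 1F ^ 3 + x)) (≡-sym (+-identityʳ _)))
             (≡-sym (*-identityʳ _))
             (two-part-bound (w 0F) (w 1F))
cubic-partition-bound {suc (suc (suc k))} n w Σw≡n = *-cancelˡ-≤ (3 + k) (begin
  (3 + k) * ((3 + k) ^ 3 * sumFin (λ i → w i * (n ∸ w i) ^ 3))
    ≡⟨ ≡-sym (*-assoc (3 + k) ((3 + k) ^ 3) (sumFin (λ i → w i * (n ∸ w i) ^ 3))) ⟩
  (3 + k) ^ 4 * sumFin (λ i → w i * (n ∸ w i) ^ 3)
    ≡⟨ *-distribˡ-sumFin ((3 + k) ^ 4) (λ i → w i * (n ∸ w i) ^ 3) ⟩
  sumFin (λ i → (3 + k) ^ 4 * (w i * (n ∸ w i) ^ 3))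
    ≤⟨ sumFin-mono-≤ (λ i → tangent-bound k (subst (w i ≤_) Σw≡n (term≤sumFin w i))) ⟩
  sumFin (λ i → A * w i + B * (n ∸ w i))
    ≡⟨ sumFin-linear A B w (λ i → n ∸ w i) ⟩
  A * sumFin w + B * sumFin (λ i → n ∸ w i)
    ≡⟨ cong₂ (λ x y → A * x + B * y) Σw≡n (sumFin-complement n w Σw≡n) ⟩
  A * n + B * ((2 + k) * n)
    ≡⟨ collect k n ⟩
  (3 + k) * (n ^ 4 * (2 + k) ^ 3) ∎)
  where
  open ≤-Reasoning
  A = k * (2 + k) ^ 3 * n ^ 3
  B = 3 * (2 + k) ^ 2 * n ^ 3
  collect : ∀ k n → let q = 2 + k in
    k * (q * (q * (q * 1))) * (n * (n * (n * 1))) * n + 3 * (q * (q * 1)) * (n * (n * (n * 1))) * (q * n)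
      ≡ (3 + k) * (n * (n * (n * (n * 1))) * (q * (q * (q * 1))))
  collect = solve-∀

corollary4p5 : (n : ℕ) (G : SimpleGraph n) (s : ℕ) → 3 ≤ s →
    (r : ℕ) → SmallPartition G s r →
    r ^ 3 * powSum G 3 allV ≤ n ^ 4 * (r ∸ 1) ^ 3
corollary4p5 n G (suc s) (s≤s 2≤s) r (f , small) = begin
  r ^ 3 * powSum G 3 allV
    ≡⟨ cong (r ^ 3 *_) (≡-sym (powSum-partition G 3 f)) ⟩
  r ^ 3 * sumFin (λ i → powSum G 3 (class f i))
    ≤⟨ *-monoʳ-≤ (r ^ 3) (sumFin-mono-≤ D₃≤n∸card) ⟩
  r ^ 3 * sumFin (λ i → card (class f i) * (n ∸ card (class f i)) ^ 3)
    ≤⟨ cubic-partition-bound n (λ i → card (class f i)) (card-partition f) ⟩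
  n ^ 4 * (r ∸ 1) ^ 3 ∎
  where
  open ≤-Reasoning
  D₃≤n∸card : ∀ i → powSum G 3 (class f i) ≤ card (class f i) * (n ∸ card (class f i)) ^ 3
  D₃≤n∸card i = powerMeanBound-antitone (𝟙 ∘ class f i) (deg G) (n ∸ card (class f i))
                  2≤s (proj₂ (small i))
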